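{- There is an absolute constant $C_0$ such that the following holds. Let $G,G'$ be graphs with cores $C,C'$ respectively, and let $d$ be the diameter of $G$. If in the Ehrenfeucht game on $(G,G')$ Duplicator does not preserve the core, i.e., at some moment vertices $x\in V(G)$, $x'\in V(G')$ with the same mark are such that exactly one of $x\in V(C)$, $x'\in V(C')$ holds, then Spoiler can win in at most $\log_2d+C_0$ further moves.
   Context: The core of a graph is obtained by repeatedly deleting, as long as possible, vertices of degree at most 1. The Ehrenfeucht game on $(G,G')$: in each round Spoiler marks a vertex of one graph with the round number and Duplicator marks a vertex of the other graph with the same number; Duplicator wins if at the end the correspondence between equally marked vertices preserves equality and adjacency, otherwise Spoiler wins. -}

module Defs where

open import Data.Nat using (ℕ; zero; suc; _+_; _≤_; _<_)
open import Data.Fin using (Fin; _≟_)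
import Data.Fin as F
open import Data.Bool using (Bool; true; false; if_then_else_; _∧_; not)
open import Data.Product using (Σ; _×_; _,_)
open import Data.Sum using (_⊎_)
open import Data.List using (List; _∷_)
open import Data.List.Membership.Propositional using (_∈_)
open import Relation.Nullary using (¬_; does)
open import Relation.Binary.PropositionalEquality using (_≡_)

record Graph : Set where
  field
    n     : ℕ
    adj   : Fin n → Fin n → Bool
    sym   : ∀ u v → adj u v ≡ adj v u
    loopless : ∀ v → adj v v ≡ false
open Graph public

VSet : Graph → Set
VSet G = Fin (n G) → Bool

count : ∀ {k} → (Fin k → Bool) → ℕ
count {zero}  f = 0
count {suc k} f = (if f F.zero then 1 else 0) + count (λ i → f (F.suc i))

degIn : (G : Graph) → VSet G → Fin (n G) → ℕ
degIn G S v = count (λ u → S u ∧ adj G v u)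

delete : (G : Graph) → VSet G → Fin (n G) → VSet G
delete G S v u = S u ∧ not (does (u ≟ v))

full : (G : Graph) → VSet G
full G _ = true

data Reach (G : Graph) : VSet G → Set where
  start : Reach G (full G)
  step  : ∀ {T} v → Reach G T → T v ≡ true → degIn G T v ≤ 1 →
          Reach G (delete G T v)

Terminal : (G : Graph) → VSet G → Set
Terminal G T = ∀ v → T v ≡ true → 2 ≤ degIn G T v

IsCore : (G : Graph) → VSet G → Set
IsCore G C = Σ (VSet G) λ T → Reach G T × Terminal G T × (∀ u → T u ≡ C u)

data Walk (G : Graph) : Fin (n G) → Fin (n G) → ℕ → Set where
  here : ∀ {u} → Walk G u u 0
  cons : ∀ {u w v ℓ} → adj G u w ≡ true → Walk G w v ℓ → Walk G u v (suc ℓ)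

DistLE : (G : Graph) → Fin (n G) → Fin (n G) → ℕ → Set
DistLE G u v k = Σ ℕ λ ℓ → ℓ ≤ k × Walk G u v ℓ

-- d is the diameter of G (in particular G is connected):
-- all distances are ≤ d and some distance equals d.
IsDiameter : Graph → ℕ → Set
IsDiameter G d =
  (∀ u v → DistLE G u v d) ×
  Σ (Fin (n G)) λ u → Σ (Fin (n G)) λ v → ∀ ℓ → ℓ < d → ¬ Walk G u v ℓ

-- A position: the list of pairs of equally marked vertices (x_i , x'_i).
Position : Graph → Graph → Set
Position G G' = List (Fin (n G) × Fin (n G'))

PartialIso : (G G' : Graph) → Position G G' → Set
PartialIso G G' p =
  ∀ a a' b b' → (a , a') ∈ p → (b , b') ∈ p →
  (does (a ≟ b) ≡ does (a' ≟ b')) × (adj G a b ≡ adj G' a' b')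

SpoilerWins : (G G' : Graph) → ℕ → Position G G' → Set
SpoilerWins G G' zero    p = ¬ PartialIso G G' p
SpoilerWins G G' (suc m) p =
  (Σ (Fin (n G))  λ x  → ∀ x' → SpoilerWins G G' m ((x , x') ∷ p)) ⊎
  (Σ (Fin (n G')) λ x' → ∀ x  → SpoilerWins G G' m ((x , x') ∷ p))

-- The core contains every vertex set of minimum degree at least 2. When all distances in G are
-- at most 2^c, membership of v in the core is witnessed by 8 vertices: two core neighbours
-- y₁ y₂ of v and, for each yᵢ, a vertex wᵢ closer to yᵢ than to v at which the geodesics from v
-- close up through one or two neighbours of wᵢ; the geodesic intervals involved, together
-- with v, form a set of minimum degree at least 2.
-- The witness consists of adjacencies, one inequality and distances at most 2^c, and by
-- distance halving Spoiler wins within c moves as soon as Duplicator changes such a distance.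
-- So after Spoiler marks the 8 vertices, Duplicator's answers witness that v' is in the core
-- of G' as well. This settles the case x ∈ C with c = ⌊log₂ d⌋ + 1. If instead x' ∈ C', either
-- some vertex of G' is farther than d from x', and Spoiler wins by halving, or all distances
-- in G' are at most 2d and the same argument runs in G' with the roles of the graphs swapped.

{-# OPTIONS --safe #-}
module Submission where

open import Defs
open import Data.Nat using (ℕ; _+_; _≤_)
open import Data.Nat.Logarithm using (⌊log₂_⌋)
open import Data.Fin using (Fin)
open import Data.Product using (Σ; _×_; _,_)
open import Data.List.Membership.Propositional using (_∈_)
open import Relation.Binary.PropositionalEquality using (_≢_)

open import Data.Nat using (zero; suc; _<_; _∸_; _^_; z≤n; s≤s; _≤?_; ⌊_/2⌋; _≤′_; ≤′-refl; ≤′-step)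
open import Data.Nat.Properties hiding (_≟_; suc-injective)
open import Data.Nat.Logarithm.Core using (⌊log2⌋)
open import Data.Nat.Induction using (<-wellFounded)
open import Induction.WellFounded using (Acc; acc)
open import Data.Fin using (zero; suc; _≟_; #_)
open import Data.Fin.Properties using (any?; all?; ¬∀⟶∃¬; suc-injective)
open import Data.Bool using (Bool; true; false; _∧_; if_then_else_)
import Data.Bool as Bool
open import Data.Bool.Properties using (∧-conicalˡ; ∧-conicalʳ)
open import Data.Product using (proj₁; proj₂; swap; ∃₂) renaming (map to map-×)
open import Data.Sum using (_⊎_; inj₁; inj₂)
open import Data.Vec using (Vec; []; _∷_; lookup)
open import Data.List using ([]; _∷_; map)
open import Data.List.Relation.Unary.Any using (here; there)
import Data.List.Relation.Unary.All as All
open import Data.List.Relation.Binary.Subset.Propositional using (_⊆_)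
open import Data.List.Relation.Binary.Subset.Propositional.Properties using (∷⁺ʳ; xs⊆x∷xs)
open import Data.List.Membership.Propositional.Properties using (∈-map⁺; ∈-map⁻)
open import Data.Empty using (⊥-elim)
open import Function using (_∘_)
open import Relation.Nullary using (¬_; Dec; yes; no; does; ¬?)
open import Relation.Nullary.Decidable using (_×-dec_; _⊎-dec_; map′; decidable-stable; dec-true)
open import Relation.Binary.Definitions using (tri<; tri≈; tri>)
open import Relation.Binary.PropositionalEquality
  using (_≡_; refl; cong; cong₂; subst; subst₂; trans) renaming (sym to ≡-sym)

-- Degrees and pruning

1≤count : ∀ {k} (f : Fin k → Bool) {a} → f a ≡ true → 1 ≤ count f
1≤count f {zero} fa rewrite fa = s≤s z≤n
1≤count f {suc a} fa = ≤-trans (1≤count (f ∘ suc) fa) (m≤n+m _ _)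

2≤count : ∀ {k} (f : Fin k → Bool) {a b} → a ≢ b → f a ≡ true → f b ≡ true → 2 ≤ count f
2≤count f {zero}  {zero}  a≢b _  _  = ⊥-elim (a≢b refl)
2≤count f {zero}  {suc b} _   fa fb rewrite fa = s≤s (1≤count (f ∘ suc) fb)
2≤count f {suc a} {zero}  _   fa fb rewrite fb = s≤s (1≤count (f ∘ suc) fa)
2≤count f {suc a} {suc b} a≢b fa fb =
  ≤-trans (2≤count (f ∘ suc) (a≢b ∘ cong suc) fa fb) (m≤n+m _ _)

1≤count⇒∃ : ∀ {k} (f : Fin k → Bool) → 1 ≤ count f → Σ (Fin k) λ a → f a ≡ true
1≤count⇒∃ {suc k} f 1≤c with f zero in f0
... | true  = zero , f0
... | false with 1≤count⇒∃ (f ∘ suc) 1≤c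
...   | a , fa = suc a , fa

2≤count⇒∃₂ : ∀ {k} (f : Fin k → Bool) → 2 ≤ count f →
             ∃₂ λ a b → a ≢ b × f a ≡ true × f b ≡ true
2≤count⇒∃₂ {suc k} f 2≤c with f zero in f0
... | true with 1≤count⇒∃ (f ∘ suc) (≤-pred 2≤c)
...   | b , fb = zero , suc b , (λ ()) , f0 , fb
2≤count⇒∃₂ {suc k} f 2≤c | false with 2≤count⇒∃₂ (f ∘ suc) 2≤c
...   | a , b , a≢b , fa , fb = suc a , suc b , a≢b ∘ suc-injective , fa , fb

TwoNeighboursIn : (G : Graph) → (Fin (n G) → Set) → Fin (n G) → Set
TwoNeighboursIn G P z = Σ (Fin (n G)) λ a → Σ (Fin (n G)) λ b →
  a ≢ b × adj G z a ≡ true × adj G z b ≡ true × P a × P b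

MinDegree≥2 : (G : Graph) → (Fin (n G) → Set) → Set
MinDegree≥2 G P = ∀ z → P z → TwoNeighboursIn G P z

twoNeighbours-map : ∀ {G} {P Q : Fin (n G) → Set} {z} →
                    (∀ {a} → P a → Q a) → TwoNeighboursIn G P z → TwoNeighboursIn G Q z
twoNeighbours-map f (a , b , a≢b , z~a , z~b , Pa , Pb) = a , b , a≢b , z~a , z~b , f Pa , f Pb

terminal⇒twoNeighbours : ∀ {G T v} → Terminal G T → T v ≡ true →
                         TwoNeighboursIn G (λ u → T u ≡ true) v
terminal⇒twoNeighbours {G} {T} {v} terminal Tv
  with 2≤count⇒∃₂ (λ u → T u ∧ adj G v u) (terminal v Tv)
... | a , b , a≢b , Ta∧v~a , Tb∧v~b =
  a , b , a≢b , ∧-conicalʳ _ _ Ta∧v~a , ∧-conicalʳ _ _ Tb∧v~b ,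
  ∧-conicalˡ _ _ Ta∧v~a , ∧-conicalˡ _ _ Tb∧v~b

minDegree≥2-survives : ∀ {G T} {P : Fin (n G) → Set} → Reach G T → MinDegree≥2 G P →
                       ∀ {z} → P z → T z ≡ true
minDegree≥2-survives start _ _ = refl
minDegree≥2-survives {G} {P = P} (step {T} v reach _ deg≤1) minDeg {z} Pz with z ≟ v
... | no _ = cong₂ _∧_ (minDegree≥2-survives reach minDeg Pz) refl
... | yes refl with minDeg z Pz
...   | a , b , a≢b , z~a , z~b , Pa , Pb = ⊥-elim (n≮n 1 (≤-trans deg≥2 deg≤1))
  where
  neighbourInT : ∀ {u} → P u → adj G z u ≡ true → T u ∧ adj G z u ≡ true
  neighbourInT Pu z~u = cong₂ _∧_ (minDegree≥2-survives reach minDeg Pu) z~u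
  deg≥2 : 2 ≤ degIn G T z
  deg≥2 = 2≤count (λ u → T u ∧ adj G z u) a≢b (neighbourInT Pa z~a) (neighbourInT Pb z~b)

-- Walks and distances

record IsDist (G : Graph) (a b : Fin (n G)) (k : ℕ) : Set where
  constructor _,_
  field
    geodesic : Walk G a b k
    shortest : ∀ {j} → j < k → ¬ Walk G a b j
open IsDist public

module _ {G : Graph} where

  private
    V = Fin (n G)

  adj-sym : ∀ {a b} → adj G a b ≡ true → adj G b a ≡ true
  adj-sym {a} {b} a~b = trans (sym G b a) a~b

  adj-irrefl : ∀ {a} → adj G a a ≢ true
  adj-irrefl {a} a~a with trans (≡-sym (loopless G a)) a~a
  ... | ()

  infixr 5 _++ʷ_
  infixl 5 _∷ʳʷ_

  _++ʷ_ : ∀ {a b c i j} → Walk G a b i → Walk G b c j → Walk G a c (i + j)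
  here       ++ʷ w' = w'
  cons a~ w  ++ʷ w' = cons a~ (w ++ʷ w')

  _∷ʳʷ_ : ∀ {a b c i} → Walk G a b i → adj G b c ≡ true → Walk G a c (suc i)
  here      ∷ʳʷ b~c = cons b~c here
  cons a~ w ∷ʳʷ b~c = cons a~ (w ∷ʳʷ b~c)

  unsnocʷ : ∀ {a c i} → Walk G a c (suc i) → Σ V λ b → Walk G a b i × adj G b c ≡ true
  unsnocʷ (cons a~c here) = _ , here , a~c
  unsnocʷ (cons a~ w@(cons _ _)) with unsnocʷ w
  ... | b , w' , b~c = b , cons a~ w' , b~c

  reverseʷ : ∀ {a b i} → Walk G a b i → Walk G b a i
  reverseʷ here        = here
  reverseʷ (cons a~ w) = reverseʷ w ∷ʳʷ adj-sym a~

  walk0⇒≡ : ∀ {a b} → Walk G a b 0 → a ≡ b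
  walk0⇒≡ here = refl

  walk? : ∀ ℓ a b → Dec (Walk G a b ℓ)
  walk? zero a b with a ≟ b
  ... | yes refl = yes here
  ... | no a≢b   = no (a≢b ∘ walk0⇒≡)
  walk? (suc ℓ) a b with any? (λ c → (adj G a c Bool.≟ true) ×-dec walk? ℓ c b)
  ... | yes (c , a~c , w) = yes (cons a~c w)
  ... | no ¬w = no λ { (cons a~c w) → ¬w (_ , a~c , w) }

  distLE? : ∀ k a b → Dec (DistLE G a b k)
  distLE? zero a b with walk? zero a b
  ... | yes w = yes (0 , z≤n , w)
  ... | no ¬w = no λ { (zero , _ , w) → ¬w w }
  distLE? (suc k) a b with walk? (suc k) a b | distLE? k a b
  ... | yes w | _                = yes (suc k , ≤-refl , w)
  ... | no _  | yes (ℓ , ℓ≤k , w) = yes (ℓ , m≤n⇒m≤1+n ℓ≤k , w)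
  ... | no ¬w | no ¬d            = no ¬distLE
    where
    ¬distLE : ¬ DistLE G a b (suc k)
    ¬distLE (ℓ , ℓ≤1+k , w) with m≤n⇒m<n∨m≡n ℓ≤1+k
    ... | inj₁ ℓ<1+k = ¬d (ℓ , ≤-pred ℓ<1+k , w)
    ... | inj₂ refl  = ¬w w

  distLE-weaken : ∀ {a b k k'} → k ≤ k' → DistLE G a b k → DistLE G a b k'
  distLE-weaken k≤k' (ℓ , ℓ≤k , w) = ℓ , ≤-trans ℓ≤k k≤k' , w

  distLE-sym : ∀ {a b k} → DistLE G a b k → DistLE G b a k
  distLE-sym (ℓ , ℓ≤k , w) = ℓ , ℓ≤k , reverseʷ w

  distLE-trans : ∀ {a b c i j} → DistLE G a b i → DistLE G b c j → DistLE G a c (i + j)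
  distLE-trans (ℓ , ℓ≤i , w) (ℓ' , ℓ'≤j , w') = ℓ + ℓ' , +-mono-≤ ℓ≤i ℓ'≤j , w ++ʷ w'

  distLE-split : ∀ i {j a b} → DistLE G a b (i + j) → Σ V λ m → DistLE G a m i × DistLE G m b j
  distLE-split zero {a = a} d = a , (0 , z≤n , here) , d
  distLE-split (suc i) {a = a} (zero , _ , here) = a , (0 , z≤n , here) , (0 , z≤n , here)
  distLE-split (suc i) (suc ℓ , s≤s ℓ≤ , cons a~ w) with distLE-split i (ℓ , ℓ≤ , w)
  ... | m , (ℓ₁ , ℓ₁≤i , w₁) , d₂ = m , (suc ℓ₁ , s≤s ℓ₁≤i , cons a~ w₁) , d₂

  isDist-minimal : ∀ {a b k ℓ} → IsDist G a b k → Walk G a b ℓ → k ≤ ℓ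
  isDist-minimal a⇝b w = ≮⇒≥ λ ℓ<k → shortest a⇝b ℓ<k w

  isDist-unique : ∀ {a b k k'} → IsDist G a b k → IsDist G a b k' → k ≡ k'
  isDist-unique d d' = ≤-antisym (isDist-minimal d (geodesic d')) (isDist-minimal d' (geodesic d))

  isDist≤distLE : ∀ {a b k N} → IsDist G a b k → DistLE G a b N → k ≤ N
  isDist≤distLE d (ℓ , ℓ≤N , w) = ≤-trans (isDist-minimal d w) ℓ≤N

  isDist-≢ : ∀ {v a b i j} → IsDist G v a i → IsDist G v b j → i ≢ j → a ≢ b
  isDist-≢ da db i≢j refl = i≢j (isDist-unique da db)

  isDist-refl : ∀ {a} → IsDist G a a 0
  isDist-refl = here , λ ()

  adj⇒isDist1 : ∀ {a b} → adj G a b ≡ true → IsDist G a b 1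
  adj⇒isDist1 {a} a~b = cons a~b here , λ { (s≤s z≤n) w →
    adj-irrefl (subst (λ b → adj G a b ≡ true) (≡-sym (walk0⇒≡ w)) a~b) }

  distLE⇒isDist : ∀ {a b} k → DistLE G a b k → Σ ℕ λ ℓ → ℓ ≤ k × IsDist G a b ℓ
  distLE⇒isDist zero (zero , _ , w) = 0 , z≤n , w , λ ()
  distLE⇒isDist {a} {b} (suc k) d with distLE? k a b
  ... | yes d' = let (ℓ , ℓ≤k , a⇝b) = distLE⇒isDist k d' in ℓ , m≤n⇒m≤1+n ℓ≤k , a⇝b
  ... | no ¬d' = let (ℓ , ℓ≤1+k , w) = d in
    ℓ , ℓ≤1+k , w , λ j<ℓ w' → ¬d' (_ , ≤-pred (<-≤-trans j<ℓ ℓ≤1+k) , w')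

  walk⇒isDist : ∀ {a b L} → Walk G a b L → Σ ℕ λ ℓ → ℓ ≤ L × IsDist G a b ℓ
  walk⇒isDist {L = L} w = distLE⇒isDist L (L , ≤-refl , w)

-- Geodesic intervals and certificates

module _ {G : Graph} where

  private
    V = Fin (n G)

  Between : V → V → ℕ → V → ℕ → Set
  Between v t k z i = Σ ℕ λ j → IsDist G v z i × IsDist G z t j × i + j ≡ k

  Interval : V → V → ℕ → V → Set
  Interval v t k z = Σ ℕ (Between v t k z)

  between⇒isDist : ∀ {v t k z i} → Between v t k z i → IsDist G v z i
  between⇒isDist (_ , v⇝z , _) = v⇝z

  between-target : ∀ {v t k} → IsDist G v t k → Between v t k t k
  between-target {k = k} v⇝t = 0 , v⇝t , isDist-refl , +-identityʳ k

  between-pred : ∀ {v t k z i} → IsDist G v t k → Between v t k z (suc i) →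
                 Σ V λ a → adj G z a ≡ true × Between v t k a i
  between-pred {v} {t} {k} {z} {i} v⇝t (j , (v-z , v-z-minimal) , (z-t , _) , 1+i+j≡k)
    with unsnocʷ v-z
  ... | a , v-a , a~z with walk⇒isDist (cons a~z z-t)
  ... | ℓ , ℓ≤1+j , a⇝t = a , adj-sym {G} a~z , ℓ , v⇝a , a⇝t , i+ℓ≡k
    where
    v⇝a : IsDist G v a i
    v⇝a = v-a , λ j<i w → v-z-minimal (s≤s j<i) (w ∷ʳʷ a~z)
    i+ℓ≡k : i + ℓ ≡ k
    i+ℓ≡k = ≤-antisym (≤-trans (+-monoʳ-≤ i ℓ≤1+j) (≤-reflexive (trans (+-suc i j) 1+i+j≡k)))
                      (isDist-minimal v⇝t (v-a ++ʷ geodesic a⇝t))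

  between-suc : ∀ {v t k z i j} → IsDist G v t k → IsDist G v z i → IsDist G z t (suc j) →
                i + suc j ≡ k → Σ V λ b → adj G z b ≡ true × Between v t k b (suc i)
  between-suc {v} {t} {k} {z} {i} {j} v⇝t (v-z , _) (cons {w = b} z~b b-t , z-t-minimal) i+1+j≡k
    with walk⇒isDist (v-z ∷ʳʷ z~b)
  ... | ℓ , ℓ≤1+i , v⇝b = b , z~b , j , subst (IsDist G v b) ℓ≡1+i v⇝b , b⇝t , 1+i+j≡k
    where
    b⇝t : IsDist G b t j
    b⇝t = b-t , λ j'<j w → z-t-minimal (s≤s j'<j) (cons z~b w)
    1+i+j≡k : suc i + j ≡ k
    1+i+j≡k = trans (≡-sym (+-suc i j)) i+1+j≡k
    ℓ≡1+i : ℓ ≡ suc i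
    ℓ≡1+i = ≤-antisym ℓ≤1+i (+-cancelʳ-≤ j (suc i) ℓ
              (≤-trans (≤-reflexive 1+i+j≡k) (isDist-minimal v⇝t (geodesic v⇝b ++ʷ b-t))))

  predecessor⇒between : ∀ {v w u k i} → IsDist G v w k → IsDist G v u i → i < k →
                        adj G w u ≡ true → Between v w k u i
  predecessor⇒between {i = i} v⇝w v⇝u i<k w~u =
    1 , v⇝u , adj⇒isDist1 (adj-sym {G} w~u) ,
    ≤-antisym (≤-trans (≤-reflexive (+-comm i 1)) i<k)
              (isDist-minimal v⇝w (geodesic v⇝u ++ʷ cons (adj-sym {G} w~u) here))

  neighbour⇒between : ∀ {v y w k j} → adj G v y ≡ true → IsDist G v w k → IsDist G y w j → j < k →
              Between v w k y 1
  neighbour⇒between {j = j} v~y v⇝w y⇝w j<k =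
    j , adj⇒isDist1 v~y , y⇝w , ≤-antisym j<k (isDist-minimal v⇝w (cons v~y (geodesic y⇝w)))

  data IntervalVertex (v t : V) (k : ℕ) (z : V) : Set where
    source : z ≡ v → IntervalVertex v t k z
    target : ∀ {i a} → z ≡ t → k ≡ suc i → adj G z a ≡ true → Between v t k a i →
             IntervalVertex v t k z
    inner  : TwoNeighboursIn G (Interval v t k) z → IntervalVertex v t k z

  intervalVertex : ∀ {v t k z i} → IsDist G v t k → Between v t k z i → IntervalVertex v t k z
  intervalVertex {i = zero} _ (_ , v⇝z , _) = source (≡-sym (walk0⇒≡ (geodesic v⇝z)))
  intervalVertex {i = suc i} v⇝t between@(zero , _ , z⇝t , 1+i+0≡k) with between-pred v⇝t between
  ... | a , z~a , a-between =
    target (walk0⇒≡ (geodesic z⇝t)) (trans (≡-sym 1+i+0≡k) (cong suc (+-identityʳ i))) z~a a-between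
  intervalVertex {i = suc i} v⇝t between@(suc j , v⇝z , z⇝t , eq)
    with between-pred v⇝t between | between-suc v⇝t v⇝z z⇝t eq
  ... | a , z~a , a-between | b , z~b , b-between =
    inner (a , b , isDist-≢ (between⇒isDist a-between) (between⇒isDist b-between) (λ ()) ,
           z~a , z~b , (_ , a-between) , (_ , b-between))

-- Geodesics from v to w close up at w, either evenly through two predecessors u₁ u₂ of w,
-- or oddly through a neighbour u₁ of w at the same distance from v (u₂ is then unused).
data Closing (G : Graph) (v w u₁ u₂ : Fin (n G)) (k : ℕ) : Set where
  even : ∀ {i₁ i₂} → u₁ ≢ u₂ → adj G w u₁ ≡ true → adj G w u₂ ≡ true →
         IsDist G v u₁ i₁ → i₁ < k → IsDist G v u₂ i₂ → i₂ < k → Closing G v w u₁ u₂ k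
  odd  : adj G w u₁ ≡ true → IsDist G v u₁ k → Closing G v w u₁ u₂ k

data Certificate (G : Graph) (v y w u₁ u₂ : Fin (n G)) : Set where
  certificate : ∀ {k j} → IsDist G v w k → IsDist G y w j → j < k → Closing G v w u₁ u₂ k →
                Certificate G v y w u₁ u₂

module _ {G : Graph} where

  private
    V = Fin (n G)

  CertifiedSet : ∀ {v y w u₁ u₂} → Certificate G v y w u₁ u₂ → V → Set
  CertifiedSet {v} {w = w} (certificate {k} _ _ _ (even _ _ _ _ _ _ _)) z = Interval {G} v w k z
  CertifiedSet {v} {w = w} {u₁} (certificate {k} _ _ _ (odd _ _)) z =
    Interval {G} v w k z ⊎ Interval {G} v u₁ k z

  y∈certifiedSet : ∀ {v y w u₁ u₂} → adj G v y ≡ true → (g : Certificate G v y w u₁ u₂) →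
                   CertifiedSet g y
  y∈certifiedSet v~y (certificate v⇝w y⇝w j<k (even _ _ _ _ _ _ _)) =
    1 , neighbour⇒between v~y v⇝w y⇝w j<k
  y∈certifiedSet v~y (certificate v⇝w y⇝w j<k (odd _ _)) =
    inj₁ (1 , neighbour⇒between v~y v⇝w y⇝w j<k)

  certifiedSet-minDegree : ∀ {v y w u₁ u₂ z} (g : Certificate G v y w u₁ u₂) → CertifiedSet g z →
                           z ≡ v ⊎ TwoNeighboursIn G (CertifiedSet g) z
  certifiedSet-minDegree (certificate v⇝w _ _ (even u₁≢u₂ w~u₁ w~u₂ v⇝u₁ i₁<k v⇝u₂ i₂<k))
                         (_ , z-between)
    with intervalVertex v⇝w z-between
  ... | source z≡v = inj₁ z≡v
  ... | target refl _ _ _ =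
    inj₂ (_ , _ , u₁≢u₂ , w~u₁ , w~u₂ ,
          (_ , predecessor⇒between v⇝w v⇝u₁ i₁<k w~u₁) ,
          (_ , predecessor⇒between v⇝w v⇝u₂ i₂<k w~u₂))
  ... | inner two = inj₂ two
  certifiedSet-minDegree (certificate v⇝w _ _ (odd w~u₁ v⇝u₁)) (inj₁ (_ , z-between))
    with intervalVertex v⇝w z-between
  ... | source z≡v = inj₁ z≡v
  ... | target refl refl w~a a-between =
    inj₂ (_ , _ , isDist-≢ (between⇒isDist a-between) v⇝u₁ (<⇒≢ (n<1+n _)) , w~a , w~u₁ ,
          inj₁ (_ , a-between) , inj₂ (_ , between-target v⇝u₁))
  ... | inner two = inj₂ (twoNeighbours-map {G} inj₁ two)
  certifiedSet-minDegree (certificate v⇝w _ _ (odd w~u₁ v⇝u₁)) (inj₂ (_ , z-between))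
    with intervalVertex v⇝u₁ z-between
  ... | source z≡v = inj₁ z≡v
  ... | target refl refl u₁~a a-between =
    inj₂ (_ , _ , isDist-≢ (between⇒isDist a-between) v⇝w (<⇒≢ (n<1+n _)) ,
          u₁~a , adj-sym {G} w~u₁ , inj₂ (_ , a-between) , inj₁ (_ , between-target v⇝w))
  ... | inner two = inj₂ (twoNeighbours-map {G} inj₂ two)

certificates⇒reach : ∀ {G T v y₁ y₂ w₁ u₁₁ u₁₂ w₂ u₂₁ u₂₂} → Reach G T → y₁ ≢ y₂ →
                     adj G v y₁ ≡ true → adj G v y₂ ≡ true →
                     Certificate G v y₁ w₁ u₁₁ u₁₂ → Certificate G v y₂ w₂ u₂₁ u₂₂ → T v ≡ true
certificates⇒reach {G} {v = v} reach y₁≢y₂ v~y₁ v~y₂ g₁ g₂ =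
  minDegree≥2-survives reach minDegree (inj₁ refl)
  where
  P : Fin (n G) → Set
  P z = z ≡ v ⊎ CertifiedSet g₁ z ⊎ CertifiedSet g₂ z
  at-v : TwoNeighboursIn G P v
  at-v = _ , _ , y₁≢y₂ , v~y₁ , v~y₂ ,
         inj₂ (inj₁ (y∈certifiedSet v~y₁ g₁)) , inj₂ (inj₂ (y∈certifiedSet v~y₂ g₂))
  minDegree : MinDegree≥2 G P
  minDegree _ (inj₁ refl) = at-v
  minDegree _ (inj₂ (inj₁ z∈S₁)) with certifiedSet-minDegree g₁ z∈S₁
  ... | inj₁ refl = at-v
  ... | inj₂ two  = twoNeighbours-map {G} (inj₂ ∘ inj₁) two
  minDegree _ (inj₂ (inj₂ z∈S₂)) with certifiedSet-minDegree g₂ z∈S₂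
  ... | inj₁ refl = at-v
  ... | inj₂ two  = twoNeighbours-map {G} (inj₂ ∘ inj₂) two

CertificateFrom : (G : Graph) → Fin (n G) → Fin (n G) → Set
CertificateFrom G v y = Σ (Fin (n G)) λ w → Σ (Fin (n G)) λ u₁ → Σ (Fin (n G)) λ u₂ →
  Certificate G v y w u₁ u₂

module BoundedDistances (H : Graph) (N : ℕ) (bounded : ∀ a b → DistLE H a b N) where

  private
    V = Fin (n H)

  dist : V → V → ℕ
  dist a b = proj₁ (distLE⇒isDist N (bounded a b))

  dist≤N : ∀ a b → dist a b ≤ N
  dist≤N a b = proj₁ (proj₂ (distLE⇒isDist N (bounded a b)))

  dist-isDist : ∀ a b → IsDist H a b (dist a b)
  dist-isDist a b = proj₂ (proj₂ (distLE⇒isDist N (bounded a b)))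

  dist-adj : ∀ s {a b} → adj H a b ≡ true → dist s b ≤ suc (dist s a)
  dist-adj s {a} a~b = isDist-minimal (dist-isDist s _) (geodesic (dist-isDist s a) ∷ʳʷ a~b)

  dist-refl : ∀ a → dist a a ≡ 0
  dist-refl a = n≤0⇒n≡0 (isDist-minimal (dist-isDist a a) here)

  dist-adj≡1 : ∀ {a b} → adj H a b ≡ true → dist a b ≡ 1
  dist-adj≡1 {a} {b} a~b = isDist-unique (dist-isDist a b) (adj⇒isDist1 a~b)

  module _ {T : VSet H} (terminal : Terminal H T) {v y : V} (v~y : adj H v y ≡ true) where

    data Layer (w c : V) : Set where
      closer  : dist v c < dist v w → Layer w c
      level   : dist v c ≡ dist v w → Layer w c
      farther : dist v c ≡ suc (dist v w) → Layer w c

    layer : ∀ {w c} → adj H w c ≡ true → Layer w c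
    layer {w} {c} w~c with <-cmp (dist v c) (dist v w)
    ... | tri< c<w _ _ = closer c<w
    ... | tri≈ _ c≡w _ = level c≡w
    ... | tri> _ _ c>w = farther (≤-antisym (dist-adj v w~c) c>w)

    OutwardStep : V → Set
    OutwardStep w = Σ V λ c → T c ≡ true × dist y c < dist v c × dist v c ≡ suc (dist v w)

    outward : ∀ {w c} → dist y w < dist v w → adj H w c ≡ true → dist v c ≡ suc (dist v w) →
              dist y c < dist v c
    outward y<v w~c e = subst (dist y _ <_) (≡-sym e) (s≤s (≤-trans (dist-adj y w~c) y<v))

    closing⇒certificate : ∀ {w u₁ u₂} → dist y w < dist v w → Closing H v w u₁ u₂ (dist v w) →
                          CertificateFrom H v y
    closing⇒certificate {w} y<v closing =
      w , _ , _ , certificate (dist-isDist v w) (dist-isDist y w) y<v closing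

    level⇒closing : ∀ {w c} → adj H w c ≡ true → dist v c ≡ dist v w → Closing H v w c c (dist v w)
    level⇒closing {c = c} w~c e = odd w~c (subst (IsDist H v c) e (dist-isDist v c))

    outward-step : ∀ {w} → T w ≡ true → dist y w < dist v w → CertificateFrom H v y ⊎ OutwardStep w
    outward-step {w} Tw y<v with terminal⇒twoNeighbours {H} terminal Tw
    ... | c₁ , c₂ , c₁≢c₂ , w~c₁ , w~c₂ , Tc₁ , Tc₂ with layer w~c₁ | layer w~c₂
    ... | farther e₁ | _          = inj₂ (c₁ , Tc₁ , outward y<v w~c₁ e₁ , e₁)
    ... | _          | farther e₂ = inj₂ (c₂ , Tc₂ , outward y<v w~c₂ e₂ , e₂)
    ... | level e₁   | _          = inj₁ (closing⇒certificate y<v (level⇒closing w~c₁ e₁))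
    ... | _          | level e₂   = inj₁ (closing⇒certificate y<v (level⇒closing w~c₂ e₂))
    ... | closer l₁  | closer l₂  = inj₁ (closing⇒certificate y<v
      (even c₁≢c₂ w~c₁ w~c₂ (dist-isDist v c₁) l₁ (dist-isDist v c₂) l₂))

    -- dist v _ grows at every outward step and is bounded by N, so N steps suffice.
    outward-search : ∀ fuel {w} → N < fuel + dist v w → T w ≡ true → dist y w < dist v w →
                     CertificateFrom H v y
    outward-search zero {w} N<dist _ _ = ⊥-elim (<⇒≱ N<dist (dist≤N v w))
    outward-search (suc fuel) {w} N<1+fuel+dist Tw y<v with outward-step Tw y<v
    ... | inj₁ found = found
    ... | inj₂ (c , Tc , y<v' , e) = outward-search fuel N<fuel+dist Tc y<v'
      where
      N<fuel+dist : N < fuel + dist v c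
      N<fuel+dist =
        subst (N <_) (trans (≡-sym (+-suc fuel _)) (cong (fuel +_) (≡-sym e))) N<1+fuel+dist

    certificate-exists : T y ≡ true → CertificateFrom H v y
    certificate-exists Ty = outward-search N (m<m+n N 0<dist) Ty y<v
      where
      0<dist : 0 < dist v y
      0<dist = subst (0 <_) (≡-sym (dist-adj≡1 v~y)) (s≤s z≤n)
      y<v : dist y y < dist v y
      y<v = subst (_< dist v y) (≡-sym (dist-refl y)) 0<dist

-- The Ehrenfeucht game

does-true : ∀ {A : Set} (a? : Dec A) → does a? ≡ true → A
does-true (yes a) _ = a

module Game (H H' : Graph) where

  private
    V  = Fin (n H)
    V' = Fin (n H')

  module _ {p : Position H H'} (iso : PartialIso H H' p) {a a' b b'}
           (a↦a' : (a , a') ∈ p) (b↦b' : (b , b') ∈ p) where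

    private
      ≟-agrees : does (a ≟ b) ≡ does (a' ≟ b')
      ≟-agrees = proj₁ (iso a a' b b' a↦a' b↦b')

    partialIso-≡ : a ≡ b → a' ≡ b'
    partialIso-≡ refl = does-true (a' ≟ b') (trans (≡-sym ≟-agrees) (dec-true (a ≟ a) refl))

    partialIso-≢ : a ≢ b → a' ≢ b'
    partialIso-≢ a≢b refl = a≢b (does-true (a ≟ b) (trans ≟-agrees (dec-true (a' ≟ a') refl)))

    partialIso-adj : adj H a b ≡ true → adj H' a' b' ≡ true
    partialIso-adj = trans (≡-sym (proj₂ (iso a a' b b' a↦a' b↦b')))

    partialIso-walk : ∀ {ℓ} → Walk H a b ℓ → ℓ ≤ 1 → Walk H' a' b' ℓ
    partialIso-walk here _ with partialIso-≡ refl
    ... | refl = here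
    partialIso-walk (cons a~b here) _ = cons (partialIso-adj a~b) here
    partialIso-walk (cons _ (cons _ _)) (s≤s ())

  partialIso? : ∀ p → Dec (PartialIso H H' p)
  partialIso? p = map′
    (λ all a a' b b' a↦a' b↦b' → All.lookup (All.lookup all a↦a') b↦b')
    (λ iso → All.tabulate λ a↦a' → All.tabulate λ b↦b' → iso _ _ _ _ a↦a' b↦b')
    (All.all? (λ e → All.all? (consistent? e) p) p)
    where
    Consistent : V × V' → V × V' → Set
    Consistent (a , a') (b , b') = (does (a ≟ b) ≡ does (a' ≟ b')) × (adj H a b ≡ adj H' a' b')
    consistent? : ∀ e f → Dec (Consistent e f)
    consistent? (a , a') (b , b') =
      (does (a ≟ b) Bool.≟ does (a' ≟ b')) ×-dec (adj H a b Bool.≟ adj H' a' b')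

  spoilerWins? : ∀ m p → Dec (SpoilerWins H H' m p)
  spoilerWins? zero    p = ¬? (partialIso? p)
  spoilerWins? (suc m) p =
    any? (λ x → all? λ x' → spoilerWins? m _) ⊎-dec any? (λ x' → all? λ x → spoilerWins? m _)

  spoilerWins-⊆ : ∀ {m p q} → p ⊆ q → SpoilerWins H H' m p → SpoilerWins H H' m q
  spoilerWins-⊆ {zero}  p⊆q ¬iso iso = ¬iso λ a a' b b' a↦a' b↦b' → iso a a' b b' (p⊆q a↦a') (p⊆q b↦b')
  spoilerWins-⊆ {suc m} p⊆q (inj₁ (x , wins)) = inj₁ (x , λ x' → spoilerWins-⊆ (∷⁺ʳ _ p⊆q) (wins x'))
  spoilerWins-⊆ {suc m} p⊆q (inj₂ (x' , wins)) = inj₂ (x' , λ x → spoilerWins-⊆ (∷⁺ʳ _ p⊆q) (wins x))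

  spoilerWins-suc : ∀ {m p} → SpoilerWins H H' m p → SpoilerWins H H' (suc m) p
  spoilerWins-suc {zero} {[]} ¬iso = ⊥-elim (¬iso λ _ _ _ _ ())
  spoilerWins-suc {zero} {(x , _) ∷ _} ¬iso = inj₁ (x , λ _ → spoilerWins-⊆ (xs⊆x∷xs _ _) ¬iso)
  spoilerWins-suc {suc m} wins@(inj₁ (x , _)) = inj₁ (x , λ _ → spoilerWins-⊆ (xs⊆x∷xs _ _) wins)
  spoilerWins-suc {suc m} wins@(inj₂ (x' , _)) = inj₂ (x' , λ _ → spoilerWins-⊆ (xs⊆x∷xs _ _) wins)

  spoilerWins-≤ : ∀ {m m' p} → m ≤ m' → SpoilerWins H H' m p → SpoilerWins H H' m' p
  spoilerWins-≤ = go ∘ ≤⇒≤′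
    where
    go : ∀ {m m' p} → m ≤′ m' → SpoilerWins H H' m p → SpoilerWins H H' m' p
    go ≤′-refl        wins = wins
    go (≤′-step m≤m') wins = spoilerWins-suc (go m≤m' wins)

  partialIso-swap : ∀ {p} → PartialIso H H' p → PartialIso H' H (map swap p)
  partialIso-swap iso _ _ _ _ a'↦a b'↦b with ∈-map⁻ swap a'↦a | ∈-map⁻ swap b'↦b
  ... | _ , a↦a' , refl | _ , b↦b' , refl = map-× ≡-sym ≡-sym (iso _ _ _ _ a↦a' b↦b')

  spoilerWins-swap : ∀ m {p} → SpoilerWins H' H m (map swap p) → SpoilerWins H H' m p
  spoilerWins-swap zero    ¬iso = ¬iso ∘ partialIso-swap
  spoilerWins-swap (suc m) (inj₁ (x' , wins)) = inj₂ (x' , λ x → spoilerWins-swap m (wins x))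
  spoilerWins-swap (suc m) (inj₂ (x , wins))  = inj₁ (x , λ x' → spoilerWins-swap m (wins x'))

  duplicatorAnswer : ∀ {m p} → ¬ SpoilerWins H H' (suc m) p →
                     ∀ x → Σ V' λ x' → ¬ SpoilerWins H H' m ((x , x') ∷ p)
  duplicatorAnswer {m} {p} survives x =
    ¬∀⟶∃¬ (n H') _ (λ x' → spoilerWins? m _) (λ wins → survives (inj₁ (x , wins)))

  duplicatorAnswers : ∀ {r c p} (xs : Vec V r) → ¬ SpoilerWins H H' (r + c) p →
    Σ (Vec V' r) λ ys → Σ (Position H H') λ q →
      p ⊆ q × (∀ i → (lookup xs i , lookup ys i) ∈ q) × ¬ SpoilerWins H H' c q
  duplicatorAnswers [] survives = [] , _ , (λ e∈p → e∈p) , (λ ()) , survives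
  duplicatorAnswers (x ∷ xs) survives with duplicatorAnswer survives x
  ... | x' , survives₁ with duplicatorAnswers xs survives₁
  ... | ys , q , p⊆q , pinned , survives' =
    x' ∷ ys , q , p⊆q ∘ there , (λ { zero → p⊆q (here refl) ; (suc i) → pinned i }) , survives'

  -- Spoiler marks a midpoint of a walk of length at most 2^(c+1); whatever Duplicator answers,
  -- one of the two halves is too long in H'.
  spoilerWins-distLE : ∀ c {k p a a' b b'} → (a , a') ∈ p → (b , b') ∈ p → k ≤ 2 ^ c →
                       DistLE H a b k → ¬ DistLE H' a' b' k → SpoilerWins H H' c p
  spoilerWins-distLE zero a↦a' b↦b' k≤1 (ℓ , ℓ≤k , w) far iso =
    far (ℓ , ℓ≤k , partialIso-walk iso a↦a' b↦b' w (≤-trans ℓ≤k k≤1))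
  spoilerWins-distLE (suc c) {k} {p} {a} {a'} {b} {b'} a↦a' b↦b' k≤2^[1+c] near far with k ≤? 2 ^ c
  ... | yes k≤2^c = spoilerWins-suc (spoilerWins-distLE c a↦a' b↦b' k≤2^c near far)
  ... | no k≰2^c = inj₁ (proj₁ halves , answer)
    where
    P = 2 ^ c
    P+[k∸P]≡k : P + (k ∸ P) ≡ k
    P+[k∸P]≡k = m+[n∸m]≡n (<⇒≤ (≰⇒> k≰2^c))
    k∸P≤P : k ∸ P ≤ P
    k∸P≤P = ≤-trans (∸-monoˡ-≤ P k≤2^[1+c]) (≤-reflexive (trans (m+n∸m≡n P (P + 0)) (+-identityʳ P)))
    halves : Σ V λ m → DistLE H a m P × DistLE H m b (k ∸ P)
    halves = distLE-split P (subst (DistLE H a b) (≡-sym P+[k∸P]≡k) near)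
    answer : ∀ m' → SpoilerWins H H' c ((proj₁ halves , m') ∷ p)
    answer m' with distLE? P a' m' | distLE? (k ∸ P) m' b'
    ... | yes near₁ | yes near₂ =
      ⊥-elim (far (subst (DistLE H' a' b') P+[k∸P]≡k (distLE-trans near₁ near₂)))
    ... | no far₁   | _         =
      spoilerWins-distLE c (there a↦a') (here refl) ≤-refl (proj₁ (proj₂ halves)) far₁
    ... | yes _     | no far₂   =
      spoilerWins-distLE c (here refl) (there b↦b') k∸P≤P (proj₂ (proj₂ halves)) far₂

survives⇒distLE : ∀ (H H' : Graph) {c q k a a' b b'} → ¬ SpoilerWins H H' c q → k ≤ 2 ^ c →
                  (a , a') ∈ q → (b , b') ∈ q → DistLE H a b k → DistLE H' a' b' k
survives⇒distLE H H' {c} {k = k} {a' = a'} {b' = b'} survives k≤2^c a↦a' b↦b' near =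
  decidable-stable (distLE? k a' b') λ far →
    survives (Game.spoilerWins-distLE H H' c a↦a' b↦b' k≤2^c near far)

module Survival (H H' : Graph) {c : ℕ} {q : Position H H'}
                (survives : ¬ SpoilerWins H H' c q) where

  open Game H H'

  partialIso : PartialIso H H' q
  partialIso = decidable-stable (partialIso? q) λ ¬iso → survives (spoilerWins-≤ z≤n ¬iso)

  module _ {a a' b b'} (a↦a' : (a , a') ∈ q) (b↦b' : (b , b') ∈ q) where

    ≢-preserved : a ≢ b → a' ≢ b'
    ≢-preserved = partialIso-≢ partialIso a↦a' b↦b'

    adj-preserved : adj H a b ≡ true → adj H' a' b' ≡ true
    adj-preserved = partialIso-adj partialIso a↦a' b↦b'

    isDist-preserved : ∀ {k} → k ≤ 2 ^ c → IsDist H a b k → IsDist H' a' b' k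
    isDist-preserved {k} k≤2^c (w , shortest)
      with survives⇒distLE H H' survives k≤2^c a↦a' b↦b' (k , ≤-refl , w)
    ... | ℓ , ℓ≤k , w' =
      subst (Walk H' a' b') (≤-antisym ℓ≤k (≮⇒≥ λ ℓ<k → shortest' ℓ<k w')) w' , shortest'
      where
      shortest' : ∀ {j} → j < k → ¬ Walk H' a' b' j
      shortest' j<k w'
        with survives⇒distLE H' H (survives ∘ spoilerWins-swap c) (≤-trans (<⇒≤ j<k) k≤2^c)
               (∈-map⁺ swap a↦a') (∈-map⁺ swap b↦b') (_ , ≤-refl , w')
      ... | i , i≤j , w = shortest (≤-<-trans i≤j j<k) w

  certificate-preserved : (∀ a b → DistLE H a b (2 ^ c)) →
    ∀ {v v' y y' w w' u₁ u₁' u₂ u₂'} → (v , v') ∈ q → (y , y') ∈ q → (w , w') ∈ q →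
    (u₁ , u₁') ∈ q → (u₂ , u₂') ∈ q → Certificate H v y w u₁ u₂ → Certificate H' v' y' w' u₁' u₂'
  certificate-preserved diam v↦v' y↦y' w↦w' u₁↦u₁' u₂↦u₂' (certificate v⇝w y⇝w j<k closing) =
    certificate (preserved v↦v' w↦w' v⇝w) (preserved y↦y' w↦w' y⇝w) j<k (closing-preserved closing)
    where
    preserved : ∀ {a a' b b' k} → (a , a') ∈ q → (b , b') ∈ q → IsDist H a b k → IsDist H' a' b' k
    preserved a↦a' b↦b' a⇝b = isDist-preserved a↦a' b↦b' (isDist≤distLE a⇝b (diam _ _)) a⇝b
    closing-preserved : ∀ {k} → Closing H _ _ _ _ k → Closing H' _ _ _ _ k
    closing-preserved (even u₁≢u₂ w~u₁ w~u₂ v⇝u₁ i₁<k v⇝u₂ i₂<k) =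
      even (≢-preserved u₁↦u₁' u₂↦u₂' u₁≢u₂)
           (adj-preserved w↦w' u₁↦u₁' w~u₁) (adj-preserved w↦w' u₂↦u₂' w~u₂)
           (preserved v↦v' u₁↦u₁' v⇝u₁) i₁<k (preserved v↦v' u₂↦u₂' v⇝u₂) i₂<k
    closing-preserved (odd w~u₁ v⇝u₁) =
      odd (adj-preserved w↦w' u₁↦u₁' w~u₁) (preserved v↦v' u₁↦u₁' v⇝u₁)

open BoundedDistances using (certificate-exists)

spoilerWins-core : ∀ (H H' : Graph) {C C' c p v v'} → IsCore H C → IsCore H' C' →
                   (∀ a b → DistLE H a b (2 ^ c)) → (v , v') ∈ p → C v ≡ true → C' v' ≡ false →
                   SpoilerWins H H' (8 + c) p
spoilerWins-core H H' {c = c} {p} {v} {v'} (T , _ , terminal , T≗C) (T' , reach' , _ , T'≗C')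
                 diam v↦v' Cv C'v'
  with terminal⇒twoNeighbours {H} terminal (trans (T≗C v) Cv)
... | y₁ , y₂ , y₁≢y₂ , v~y₁ , v~y₂ , Ty₁ , Ty₂
  with certificate-exists H (2 ^ c) diam terminal v~y₁ Ty₁
     | certificate-exists H (2 ^ c) diam terminal v~y₂ Ty₂
... | w₁ , u₁₁ , u₁₂ , g₁ | w₂ , u₂₁ , u₂₂ , g₂ =
  decidable-stable (Game.spoilerWins? H H' (8 + c) p) λ survives →
    let (answers , _ , p⊆q , pinned , survives') =
          Game.duplicatorAnswers H H' pinnedVertices survives
    in true≢false (trans (≡-sym (v'∈core answers p⊆q pinned survives')) (trans (T'≗C' v') C'v'))
  where
  pinnedVertices : Vec (Fin (n H)) 8
  pinnedVertices = y₁ ∷ y₂ ∷ w₁ ∷ u₁₁ ∷ u₁₂ ∷ w₂ ∷ u₂₁ ∷ u₂₂ ∷ []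
  true≢false : true ≢ false
  true≢false ()
  v'∈core : ∀ ys {q} → p ⊆ q → (∀ i → (lookup pinnedVertices i , lookup ys i) ∈ q) →
            ¬ SpoilerWins H H' c q → T' v' ≡ true
  v'∈core _ p⊆q pinned survives = certificates⇒reach reach'
    (≢-preserved (pinned (# 0)) (pinned (# 1)) y₁≢y₂)
    (adj-preserved (p⊆q v↦v') (pinned (# 0)) v~y₁)
    (adj-preserved (p⊆q v↦v') (pinned (# 1)) v~y₂)
    (certificate-preserved diam (p⊆q v↦v') (pinned (# 0))
                           (pinned (# 2)) (pinned (# 3)) (pinned (# 4)) g₁)
    (certificate-preserved diam (p⊆q v↦v') (pinned (# 1))
                           (pinned (# 5)) (pinned (# 6)) (pinned (# 7)) g₂)
    where open Survival H H' survives

≢-cases : ∀ {b b' : Bool} → b ≢ b' → (b ≡ true × b' ≡ false) ⊎ (b ≡ false × b' ≡ true)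
≢-cases {true}  {true}  b≢b' = ⊥-elim (b≢b' refl)
≢-cases {true}  {false} _    = inj₁ (refl , refl)
≢-cases {false} {true}  _    = inj₂ (refl , refl)
≢-cases {false} {false} b≢b' = ⊥-elim (b≢b' refl)

spoilerWins-coreMismatch : ∀ {G G' C C' d p x x'} c → d ≤ 2 ^ c → IsCore G C → IsCore G' C' →
                           (∀ a b → DistLE G a b d) → (x , x') ∈ p → C x ≢ C' x' →
                           SpoilerWins G G' (9 + c) p
spoilerWins-coreMismatch {G} {G'} {d = d} {p} {x} {x'} c d≤2^c core core' diam x↦x' Cx≢C'x'
  with ≢-cases Cx≢C'x'
... | inj₁ (Cx , C'x') =
  spoilerWins-≤ (n≤1+n _) (spoilerWins-core G G' core core' diam-≤2^c x↦x' Cx C'x')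
  where
  open Game G G'
  diam-≤2^c : ∀ a b → DistLE G a b (2 ^ c)
  diam-≤2^c a b = distLE-weaken d≤2^c (diam a b)
... | inj₂ (Cx , C'x') with all? (λ z' → distLE? d x' z')
...   | yes near =
  spoilerWins-swap (9 + c) (spoilerWins-core G' G core' core diam' (∈-map⁺ swap x↦x') C'x' Cx)
  where
  open Game G G'
  diam' : ∀ a b → DistLE G' a b (2 ^ (1 + c))
  diam' a b = distLE-weaken (+-mono-≤ d≤2^c (≤-trans d≤2^c (m≤m+n _ 0)))
                            (distLE-trans (distLE-sym (near a)) (near b))
...   | no ¬near with ¬∀⟶∃¬ _ _ (λ z' → distLE? d x' z') ¬near
...     | z' , far = spoilerWins-≤ (m≤n+m _ 8)
  (inj₂ (z' , λ z → spoilerWins-distLE c (there x↦x') (here refl) d≤2^c (diam x z) far))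
  where open Game G G'

n≤1+2⌊n/2⌋ : ∀ n → n ≤ suc (⌊ n /2⌋ + ⌊ n /2⌋)
n≤1+2⌊n/2⌋ zero          = z≤n
n≤1+2⌊n/2⌋ (suc zero)    = s≤s z≤n
n≤1+2⌊n/2⌋ (suc (suc n)) =
  s≤s (s≤s (≤-trans (n≤1+2⌊n/2⌋ n) (≤-reflexive (≡-sym (+-suc ⌊ n /2⌋ ⌊ n /2⌋)))))

n<2^[1+⌊log₂n⌋] : ∀ n → n < 2 ^ suc ⌊log₂ n ⌋
n<2^[1+⌊log₂n⌋] n = go n (<-wellFounded n)
  where
  go : ∀ n (acc : Acc _<_ n) → n < 2 ^ suc (⌊log2⌋ n acc)
  go zero          _        = s≤s z≤n
  go (suc zero)    _        = s≤s (s≤s z≤n)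
  go (suc (suc n)) (acc rs) = begin-strict
    suc (suc n)                ≤⟨ s≤s (s≤s (n≤1+2⌊n/2⌋ n)) ⟩
    3 + (h + h)                <⟨ n<1+n _ ⟩
    4 + (h + h)                ≡⟨ cong (2 +_) (≡-sym (trans (+-suc h (suc h)) (cong suc (+-suc h h)))) ⟩
    (2 + h) + (2 + h)          ≤⟨ +-mono-≤ ih (≤-trans ih (≤-reflexive (≡-sym (+-identityʳ _)))) ⟩
    2 ^ suc (⌊log2⌋ (suc (suc n)) (acc rs)) ∎
    where
    open ≤-Reasoning
    h : ℕ
    h = ⌊ n /2⌋
    ih : suc h < 2 ^ suc (⌊log2⌋ (suc h) (rs (⌊n/2⌋<n (suc n))))
    ih = go (suc h) (rs (⌊n/2⌋<n (suc n)))

lemma5 : Σ ℕ λ C₀ →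
    ∀ (G G' : Graph) (C : VSet G) (C' : VSet G') →
    IsCore G C → IsCore G' C' →
    ∀ (d : ℕ) → IsDiameter G d →
    ∀ (p : Position G G') (x : Fin (n G)) (x' : Fin (n G')) →
    (x , x') ∈ p → C x ≢ C' x' →
    Σ ℕ λ m → m ≤ ⌊log₂ d ⌋ + C₀ × SpoilerWins G G' m p
lemma5 = 10 , λ G G' C C' core core' d diam p x x' x↦x' Cx≢C'x' →
  10 + ⌊log₂ d ⌋ , ≤-reflexive (+-comm 10 _) ,
  spoilerWins-coreMismatch (suc ⌊log₂ d ⌋) (<⇒≤ (n<2^[1+⌊log₂n⌋] d))
                           core core' (proj₁ diam) x↦x' Cx≢C'x'
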